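{- Let $k\ge 2$, $n,N\ge 1$ and $b\ge 0$ be integers. Let $f:[n]^{k-1}\times[N]\to\{0,1\}$ be a graph function and let $A=\mathrm{Base}(f):[n]^{k-1}\to[N]$. Then $$D_k(f)\ \ge\ \min\{\,D^{h}_{k-1,b}(A)-(k-1)N,\ b\,\}.$$
   Context: Number-on-the-forehead (NOF) model: $m$ players receive an input $(x_1,\ldots,x_m)\in X_1\times\cdots\times X_m$; player $i$ sees every $x_j$ with $j\neq i$ but not $x_i$. The players take turns writing bits on a common blackboard according to a fixed protocol; each written bit depends only on what the writer sees and on the previous content of the blackboard. The communication ends when all players know the value of the function. The cost of a protocol is the maximum over all inputs of the number of bits written; $D_m(g)$ is the minimum cost of a deterministic protocol computing $g$. A function $f:[n]^{k-1}\times[N]\to\{0,1\}$ is a graph function if for every $(x_1,\ldots,x_{k-1})\in[n]^{k-1}$ there is a unique $y\in[N]$ with $f(x_1,\ldots,x_{k-1},y)=1$. Then $\mathrm{Base}(f):[n]^{k-1}\to[N]$ maps $(x_1,\ldots,x_{k-1})$ to this unique $y$. Communication with help: for $A:[n]^{m}\to[N]$, a deterministic protocol with $b$ help bits works as follows. On input $(x_1,\ldots,x_m)$, a helper who sees the entire input first writes a help string of at most $b$ bits, which may depend arbitrarily on the input. Then the $m$ players, in the NOF model, communicate deterministically and must determine $A(x_1,\ldots,x_m)$. The cost of such a protocol is the maximum over inputs of the help-string length plus the number of subsequently communicated bits. $D^{h}_{m,b}(A)$ is the minimum cost of such a protocol. -}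

module Defs where

open import Data.Nat using (ℕ; zero; suc; _+_; _≤_)
open import Data.Fin using (Fin; toℕ)
open import Data.Bool using (Bool; true; false; if_then_else_)
open import Data.List using (List; length)
open import Data.Product using (Σ; _×_; _,_; proj₁; ∃!)
open import Data.Sum using (_⊎_)
open import Relation.Binary.PropositionalEquality using (_≡_; _≢_)

-- I : input set, p players (Fin p), Same i x y : player i cannot
-- distinguish x from y (they agree on everything player i sees),
-- O : output set.  The position in the tree is the
-- blackboard content.

module Protocols (I : Set) (p : ℕ) (Same : Fin p → I → I → Set) (O : Set) where

  data Prot : Set where
    out   : O → Prot
    speak : (i : Fin p) (g : I → Bool) →
            (∀ x y → Same i x y → g x ≡ g y) →
            (ifFalse ifTrue : Prot) → Prot

  bits : Prot → I → ℕ
  bits (out _) x = 0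
  bits (speak i g _ l r) x with g x
  ... | true  = suc (bits r x)
  ... | false = suc (bits l x)

  result : Prot → I → O
  result (out o) x = o
  result (speak i g _ l r) x with g x
  ... | true  = result r x
  ... | false = result l x

  Computes : Prot → (I → O) → Set
  Computes P F = ∀ x → result P x ≡ F x

  CostAtMost : Prot → ℕ → Set
  CostAtMost P c = ∀ x → bits P x ≤ c

  DAtMost : (I → O) → ℕ → Set
  DAtMost F c = Σ Prot λ P → Computes P F × CostAtMost P c

  -- D^h_b(F) ≤ c : a helper seeing the whole input writes a string of
  -- at most b bits; then the players run a protocol (chosen according
  -- to the help string, which is on the board); cost is max over
  -- inputs of help length + communicated bits.
  DHelpAtMost : ℕ → (I → O) → ℕ → Set
  DHelpAtMost b F c =
    Σ (I → List Bool) λ h → Σ (List Bool → Prot) λ P →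
      (∀ x → length (h x) ≤ b) ×
      (∀ x → result (P (h x)) x ≡ F x) ×
      (∀ x → length (h x) + bits (P (h x)) x ≤ c)

SameNOF : (m n : ℕ) → Fin m → (Fin m → Fin n) → (Fin m → Fin n) → Set
SameNOF m n i x x' = ∀ j → j ≢ i → x j ≡ x' j

-- NOF for k = m + 1 players on [n]^m × [N]: players with toℕ j < m
-- hold x_j on their forehead, the player with toℕ j ≡ m holds y.
SameGraph : (m n N : ℕ) → Fin (suc m) →
            (Fin m → Fin n) × Fin N → (Fin m → Fin n) × Fin N → Set
SameGraph m n N j (x , y) (x' , y') =
  (toℕ j ≡ m ⊎ y ≡ y') × (∀ i → toℕ i ≢ toℕ j → x i ≡ x' i)

IsGraphFunction : {m n N : ℕ} → ((Fin m → Fin n) → Fin N → Bool) → Set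
IsGraphFunction {m} {n} {N} f =
  ∀ (x : Fin m → Fin n) → ∃! _≡_ (λ (y : Fin N) → f x y ≡ true)

Base : {m n N : ℕ} (f : (Fin m → Fin n) → Fin N → Bool) →
       IsGraphFunction f → (Fin m → Fin n) → Fin N
Base f gf x = proj₁ (gf x)

DGraphAtMost : (m n N : ℕ) → ((Fin m → Fin n) → Fin N → Bool) → ℕ → Set
DGraphAtMost m n N f c =
  Protocols.DAtMost ((Fin m → Fin n) × Fin N) (suc m) (SameGraph m n N) Bool
    (λ { (x , y) → f x y }) c

DHelpNOFAtMost : (m n N b : ℕ) → ((Fin m → Fin n) → Fin N) → ℕ → Set
DHelpNOFAtMost m n N b A c =
  Protocols.DHelpAtMost (Fin m → Fin n) m (SameNOF m n) (Fin N) b A c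

module Submission where

-- If b ≤ c there is nothing to prove, so let P be a k-player protocol for f of cost c < b.
-- The helper writes the transcript of P on (x, A x). For each candidate y in turn, the
-- k − 1 players check with one bit each that this transcript is consistent with (x, y):
-- player i recomputes every bit that player i of P would write on (x, y), which it can do
-- since it sees the same coordinates of x and y is public; the bits of the player holding
-- y do not depend on y at all. If every check passes, the transcript is also that of
-- (x, y), so f (x , y) = f (x , A x) = 1 and hence y = A x. Trying all N candidates
-- costs (k − 1) N bits.

open import Defs
open import Data.Bool using (Bool; true; false; _∧_; if_then_else_)
import Data.Bool.Properties as Bool
open import Data.Bool.Properties using (∧-conicalˡ; ∧-conicalʳ)
open import Data.Empty using (⊥-elim)
open import Data.Fin using (Fin; zero; suc; toℕ; lower₁; fromℕ<)
open import Data.Fin.Properties using (toℕ-lower₁)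
open import Data.List using (List; []; _∷_; length; allFin)
open import Data.List.Properties using (length-tabulate)
open import Data.List.Membership.Propositional using (_∈_)
open import Data.List.Membership.Propositional.Properties using (∈-allFin)
open import Data.List.Relation.Unary.Any using (here; there)
open import Data.Nat using (ℕ; zero; suc; _+_; _*_; _∸_; _≤_; _≟_; _≤?_; z≤n)
open import Data.Nat.Properties using (≤-trans; +-mono-≤; +-monoʳ-≤; *-comm; ≰⇒>; <⇒≤; module ≤-Reasoning)
open import Data.Product using (_×_; _,_; proj₁; proj₂)
open import Data.Sum using (_⊎_; inj₁; inj₂)
open import Data.Vec.Functional using (foldr; tail)
open import Function using (id)
open import Relation.Binary.PropositionalEquality
open import Relation.Nullary using (yes; no; does)
open import Relation.Nullary.Decidable using (dec-true)

conj : ∀ {L} → (Fin L → Bool) → Bool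
conj = foldr _∧_ true

conj-true⁺ : ∀ {L} (b : Fin L → Bool) → (∀ l → b l ≡ true) → conj b ≡ true
conj-true⁺ {zero}  b all-true = refl
conj-true⁺ {suc L} b all-true = cong₂ _∧_ (all-true zero) (conj-true⁺ (tail b) (λ l → all-true (suc l)))

conj-true⁻ : ∀ {L} (b : Fin L → Bool) → conj b ≡ true → ∀ l → b l ≡ true
conj-true⁻ b conj≡true zero    = ∧-conicalˡ _ _ conj≡true
conj-true⁻ b conj≡true (suc l) = conj-true⁻ (tail b) (∧-conicalʳ _ _ conj≡true) l

module _ {m n N} {f : (Fin m → Fin n) → Fin N → Bool} (gf : IsGraphFunction f) where

  Base-satisfies : ∀ x → f x (Base f gf x) ≡ true
  Base-satisfies x = proj₁ (proj₂ (gf x))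

  Base-unique : ∀ {x y} → f x y ≡ true → y ≡ Base f gf x
  Base-unique {x} fxy = sym (proj₂ (proj₂ (gf x)) fxy)

module Transcripts (I : Set) (p : ℕ) (Same : Fin p → I → I → Set) (O : Set) where
  open Protocols I p Same O

  transcript : Prot → I → List Bool
  transcript (out _)           x = []
  transcript (speak _ g _ l r) x with g x
  ... | true  = true  ∷ transcript r x
  ... | false = false ∷ transcript l x

  length-transcript : ∀ P x → length (transcript P x) ≡ bits P x
  length-transcript (out _)           x = refl
  length-transcript (speak _ g _ l r) x with g x
  ... | true  = cong suc (length-transcript r x)
  ... | false = cong suc (length-transcript l x)

module Verification (I : Set) (p : ℕ) (Same : Fin p → I → I → Set) (O : Set) where
  open Protocols I p Same O

  record Query : Set where
    constructor ask
    field
      player : Fin p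
      bit    : I → Bool
      local  : ∀ x x' → Same player x x' → bit x ≡ bit x'
  open Query

  allYes : ∀ {L} → (Fin L → Query) → I → Bool
  allYes qs x = conj (λ l → bit (qs l) x)

  announce : ∀ {L} → (Fin L → Query) → (Bool → Prot) → Prot
  announce {zero}  qs k = k true
  announce {suc L} qs k = speak (player (qs zero)) (bit (qs zero)) (local (qs zero))
    (announce (tail qs) (λ _ → k false)) (announce (tail qs) k)

  result-announce : ∀ {L} (qs : Fin L → Query) k x →
                    result (announce qs k) x ≡ result (k (allYes qs x)) x
  result-announce {zero}  qs k x = refl
  result-announce {suc L} qs k x with bit (qs zero) x
  ... | true  = result-announce (tail qs) k x
  ... | false = result-announce (tail qs) (λ _ → k false) x

  bits-announce : ∀ {L} (qs : Fin L → Query) k x →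
                  bits (announce qs k) x ≡ L + bits (k (allYes qs x)) x
  bits-announce {zero}  qs k x = refl
  bits-announce {suc L} qs k x with bit (qs zero) x
  ... | true  = cong suc (bits-announce (tail qs) k x)
  ... | false = cong suc (bits-announce (tail qs) (λ _ → k false) x)

  search : ∀ {L} → O → (O → Fin L → Query) → List O → Prot
  search o₀ V []       = out o₀
  search o₀ V (o ∷ os) = announce (V o) (λ ok → if ok then out o else search o₀ V os)

  bits-search : ∀ {L} o₀ (V : O → Fin L → Query) os x → bits (search o₀ V os) x ≤ length os * L
  bits-search o₀ V []       x = z≤n
  bits-search {L} o₀ V (o ∷ os) x
    rewrite bits-announce (V o) (λ ok → if ok then out o else search o₀ V os) x
    with allYes (V o) x
  ... | true  = +-monoʳ-≤ L z≤n
  ... | false = +-monoʳ-≤ L (bits-search o₀ V os x)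

  result-search : ∀ {L} o₀ (V : O → Fin L → Query) os x {a} → a ∈ os → allYes (V a) x ≡ true →
                  (∀ o → allYes (V o) x ≡ true → o ≡ a) → result (search o₀ V os) x ≡ a
  result-search o₀ V (o ∷ os) x a∈os a-yes unique
    rewrite result-announce (V o) (λ ok → if ok then out o else search o₀ V os) x
    with allYes (V o) x in o-yes
  ... | true = unique o o-yes
  result-search o₀ V (o ∷ os) x (here refl)  a-yes unique | false with trans (sym o-yes) a-yes
  ... | ()
  result-search o₀ V (o ∷ os) x (there a∈os) a-yes unique | false = result-search o₀ V os x a∈os a-yes unique

module FromGraphProtocol (m n N : ℕ) where
  Input : Set
  Input = Fin m → Fin n

  module G = Protocols (Input × Fin N) (suc m) (SameGraph m n N) Bool
  module H = Protocols Input m (SameNOF m n) (Fin N)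
  open Transcripts (Input × Fin N) (suc m) (SameGraph m n N) Bool
  open Verification Input m (SameNOF m n) (Fin N)

  LocalTo : Fin (suc m) → (Input × Fin N → Bool) → Set
  LocalTo j g = ∀ z w → SameGraph m n N j z w → g z ≡ g w

  -- u is player i's recomputation of a bit that speaker j wrote as t; only the bits of the
  -- speaker with the same index are player i's to check.
  checkBit : Fin (suc m) → Fin m → Bool → Bool → Bool
  checkBit j i u t with toℕ j ≟ toℕ i
  ... | yes _ = does (u Bool.≟ t)
  ... | no  _ = true

  checkBit-refl : ∀ j i t → checkBit j i t t ≡ true
  checkBit-refl j i t with toℕ j ≟ toℕ i
  ... | yes _ = dec-true (t Bool.≟ t) refl
  ... | no  _ = refl

  checkBit-sound : ∀ {j i} u t → toℕ j ≡ toℕ i → checkBit j i u t ≡ true → u ≡ t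
  checkBit-sound {j} {i} u t j≡i ok with toℕ j ≟ toℕ i
  ... | no j≢i = ⊥-elim (j≢i j≡i)
  ... | yes _ with u Bool.≟ t
  ...   | yes u≡t = u≡t
  checkBit-sound u t j≡i () | yes _ | no _

  sameGraph-sameNOF : ∀ {j i x x'} y → toℕ j ≡ toℕ i → SameNOF m n i x x' →
                      SameGraph m n N j (x , y) (x' , y)
  sameGraph-sameNOF y j≡i same =
    inj₂ refl , λ i' i'≢j → same i' (λ i'≡i → i'≢j (trans (cong toℕ i'≡i) (sym j≡i)))

  checkBit-local : ∀ j i {g} → LocalTo j g → ∀ y t {x x'} → SameNOF m n i x x' →
                   checkBit j i (g (x , y)) t ≡ checkBit j i (g (x' , y)) t
  checkBit-local j i g-local y t same with toℕ j ≟ toℕ i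
  ... | yes j≡i = cong (λ u → does (u Bool.≟ t)) (g-local _ _ (sameGraph-sameNOF y j≡i same))
  ... | no  _   = refl

  checkBit-determines : ∀ j {g} → LocalTo j g → ∀ {x y y₀ t} → g (x , y₀) ≡ t →
                        (∀ i → checkBit j i (g (x , y)) t ≡ true) → g (x , y) ≡ t
  checkBit-determines j g-local g₀≡t ok with m ≟ toℕ j
  ... | yes m≡j = trans (g-local _ _ (inj₁ (sym m≡j) , λ _ _ → refl)) g₀≡t
  ... | no  m≢j = checkBit-sound _ _ (sym (toℕ-lower₁ j m≢j)) (ok (lower₁ j m≢j))

  consistent : G.Prot → List Bool → Fin N → Fin m → Input → Bool
  consistent (G.out _)           _       y i x = true
  consistent (G.speak _ _ _ _ _) []      y i x = true
  consistent (G.speak j g _ l r) (t ∷ T) y i x =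
    checkBit j i (g (x , y)) t ∧ consistent (if t then r else l) T y i x

  consistent-local : ∀ P T y i {x x'} → SameNOF m n i x x' → consistent P T y i x ≡ consistent P T y i x'
  consistent-local (G.out _)                 _       y i same = refl
  consistent-local (G.speak _ _ _ _ _)       []      y i same = refl
  consistent-local (G.speak j g g-local l r) (t ∷ T) y i same =
    cong₂ _∧_ (checkBit-local j i g-local y t same) (consistent-local (if t then r else l) T y i same)

  consistent-transcript : ∀ P x y i → consistent P (transcript P (x , y)) y i x ≡ true
  consistent-transcript (G.out _)           x y i = refl
  consistent-transcript (G.speak j g _ l r) x y i with g (x , y) in e
  ... | true  rewrite e = cong₂ _∧_ (checkBit-refl j i true)  (consistent-transcript r x y i)
  ... | false rewrite e = cong₂ _∧_ (checkBit-refl j i false) (consistent-transcript l x y i)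

  consistent-result : ∀ P x y y₀ → (∀ i → consistent P (transcript P (x , y₀)) y i x ≡ true) →
                      G.result P (x , y) ≡ G.result P (x , y₀)
  consistent-result (G.out _)                 x y y₀ ok = refl
  consistent-result (G.speak j g g-local l r) x y y₀ ok with g (x , y₀) in e
  ... | true
    rewrite checkBit-determines j g-local e (λ i → ∧-conicalˡ _ _ (ok i))
    = consistent-result r x y y₀ (λ i → ∧-conicalʳ _ _ (ok i))
  ... | false
    rewrite checkBit-determines j g-local e (λ i → ∧-conicalˡ _ _ (ok i))
    = consistent-result l x y y₀ (λ i → ∧-conicalʳ _ _ (ok i))

  DGraphAtMost⇒DHelpNOFAtMost : ∀ {f b c} (gf : IsGraphFunction f) → Fin N →
    DGraphAtMost m n N f c → c ≤ b → DHelpNOFAtMost m n N b (Base f gf) (c + m * N)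
  DGraphAtMost⇒DHelpNOFAtMost {f} {b} {c} gf y₀ (P , P-computes , P-cost) c≤b =
    help , verify , (λ x → ≤-trans (help-cost x) c≤b) , verify-correct ,
    λ x → +-mono-≤ (help-cost x) (verify-cost (help x) x)
    where
      A = Base f gf

      help : Input → List Bool
      help x = transcript P (x , A x)

      verifier : List Bool → Fin N → Fin m → Query
      verifier T y i = ask i (consistent P T y i) (λ _ _ → consistent-local P T y i)

      verify : List Bool → H.Prot
      verify T = search y₀ (verifier T) (allFin N)

      help-cost : ∀ x → length (help x) ≤ c
      help-cost x rewrite length-transcript P (x , A x) = P-cost (x , A x)

      verify-cost : ∀ T x → H.bits (verify T) x ≤ m * N
      verify-cost T x = begin
        H.bits (verify T) x  ≤⟨ bits-search y₀ (verifier T) (allFin N) x ⟩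
        length (allFin N) * m ≡⟨ cong (_* m) (length-tabulate {n = N} id) ⟩
        N * m                ≡⟨ *-comm N m ⟩
        m * N                ∎
        where open ≤-Reasoning

      accepted⇒Base : ∀ x y → allYes (verifier (help x) y) x ≡ true → y ≡ A x
      accepted⇒Base x y accepted = Base-unique gf (begin
        f x y                 ≡⟨ sym (P-computes (x , y)) ⟩
        G.result P (x , y)    ≡⟨ consistent-result P x y (A x) (conj-true⁻ _ accepted) ⟩
        G.result P (x , A x)  ≡⟨ P-computes (x , A x) ⟩
        f x (A x)             ≡⟨ Base-satisfies gf x ⟩
        true                  ∎)
        where open ≡-Reasoning

      verify-correct : ∀ x → H.result (verify (help x)) x ≡ A x
      verify-correct x = result-search y₀ (verifier (help x)) (allFin N) x (∈-allFin (A x))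
        (conj-true⁺ _ (consistent-transcript P x (A x))) (accepted⇒Base x)

theorem1 : (k n N b : ℕ) → 2 ≤ k → 1 ≤ n → 1 ≤ N →
    (f : (Fin (k ∸ 1) → Fin n) → Fin N → Bool) →
    (gf : IsGraphFunction f) →
    (c : ℕ) → DGraphAtMost (k ∸ 1) n N f c →
    b ≤ c ⊎ DHelpNOFAtMost (k ∸ 1) n N b (Base f gf) (c + (k ∸ 1) * N)
-- Neither k ≥ 2 nor n ≥ 1 is needed; N ≥ 1 only provides a default output.
theorem1 k n N b _ _ 0<N f gf c graphProtocol with b ≤? c
... | yes b≤c = inj₁ b≤c
... | no  b≰c = inj₂ (DGraphAtMost⇒DHelpNOFAtMost gf (fromℕ< 0<N) graphProtocol (<⇒≤ (≰⇒> b≰c)))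
  where open FromGraphProtocol (k ∸ 1) n N
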